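{- Let $k\ge3$ be odd, let $H$ be a Kimura Hadamard matrix of order $8k+4$, let $p>3$ be a prime dividing $|\mathrm{Aut}(H)|$, and let $(R,S)\in\mathrm{Aut}(H)$ be an automorphism of order $p$ in which both $R$ and $S$ have block monomial form. Then $R=\mathrm{diag}(I_4,R_1,\dots,R_8)$ and $S=\mathrm{diag}(I_4,S_1,\dots,S_8)$ where each $R_i,S_i$ ($i=1,\dots,8$) is a $k\times k$ signed permutation matrix.
   Context: $D_{2k}=\langle x,y\mid x^k=1,\ y^2=1,\ y^{ -1}xy=x^{ -1}\rangle$, with elements listed in the order $x^0,\dots,x^{k-1},y,xy,\dots,x^{k-1}y$, which indexes rows and columns of $2k\times2k$ matrices. $\rho(g)=[\delta_{ug,v}]_{u,v}$ is the right regular matrix representation, extended linearly to $\mathbb{Z}D_{2k}$; for $w\in\mathbb{Z}D_{2k}$ with coefficients in $\{0,1\}$ its associated $\pm1$-matrix is $2\rho(w)-J_{2k}$. A Kimura Hadamard matrix of order $8k+4$ is a matrix \[ H=\begin{bmatrix} 1& 1 & 1 & 1 & \mathbf{1} & \mathbf{1} & \mathbf{1} & \mathbf{1}\\ 1& 1 & -1 & -1 & \mathbf{1} & \mathbf{1} & -\mathbf{1} & -\mathbf{1}\\ 1& -1 & 1 & -1 & \mathbf{1} & -\mathbf{1} & \mathbf{1} & -\mathbf{1}\\ 1& -1 & -1 & 1 & -\mathbf{1} & \mathbf{1} & \mathbf{1} & -\mathbf{1}\\ \mathbf{1}^\intercal & \mathbf{1}^\intercal & \mathbf{1}^\intercal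 & -\mathbf{1}^\intercal & A & B& C & D\\ \mathbf{1}^\intercal & \mathbf{1}^\intercal& -\mathbf{1}^\intercal & \mathbf{1}^\intercal & -B & A & D & -C\\ \mathbf{1}^\intercal & -\mathbf{1}^\intercal& \mathbf{1}^\intercal & \mathbf{1}^\intercal & -C & -D & A & B\\ \mathbf{1}^\intercal & -\mathbf{1}^\intercal& -\mathbf{1}^\intercal & -\mathbf{1}^\intercal & D & -C & B & -A \end{bmatrix} \] ($\mathbf 1$ the all-ones row vector of length $2k$) with $HH^\intercal=(8k+4)I_{8k+4}$, where $A,B,C,D$ are the $\pm1$-matrices associated to some $a,b,c,d\in\mathbb{Z}D_{2k}$ with coefficients in $\{0,1\}$. $\mathrm{Aut}(H)=\{(R,S): R,S\ \text{are}\ (8k+4)\times(8k+4)\ \text{signed permutation matrices},\ RHS^\intercal=H\}$. A matrix $M$ of size $8k+4$ has block monomial form if $M=\mathrm{diag}(M_0,M')$ where $M_0$ is a $4\times4$ signed permutation matrix and $M'$ is an $8k\times 8k$ matrix which, partitioned into a $4\times4$ array of $2k\times2k$ blocks, has exactly one nonzero block in each block row and each block column, and each nonzero $2k\times2k$ block, partitioned into a $2\times2$ array of $k\times k$ sub-blocks, has exactly one nonzero sub-block in each sub-block row and column, each nonzero sub-block being a $k\times k$ signed permutation matrix. -}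

module Defs where

open import Data.Nat as ℕ using (ℕ; zero; suc; _∸_)
open import Data.Nat.DivMod using (_mod_)
open import Data.Integer as ℤ using (ℤ; +_; -_; _*_; _+_; _-_)
open import Data.Fin as Fin using (Fin; zero; suc; toℕ; splitAt; remQuot; join; combine; _≟_)
open import Data.Fin.Permutation using (Permutation′; _⟨$⟩ʳ_)
open import Data.Bool using (Bool; true; false; if_then_else_)
open import Data.Sum using (_⊎_; inj₁; inj₂)
open import Data.Product using (Σ; _×_; _,_; proj₁; proj₂; ∃)
open import Relation.Nullary using (¬_; does)
open import Relation.Binary.PropositionalEquality using (_≡_)

Mat : ℕ → ℕ → Set
Mat m n = Fin m → Fin n → ℤ

SqMat : ℕ → Set
SqMat n = Mat n n

∑ : ∀ {n} → (Fin n → ℤ) → ℤ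
∑ {zero}  f = + 0
∑ {suc n} f = f zero + ∑ (λ i → f (suc i))

_⊗_ : ∀ {m n o} → Mat m n → Mat n o → Mat m o
(M ⊗ N) i j = ∑ (λ l → M i l * N l j)

infixl 7 _⊗_

_ᵀ : ∀ {m n} → Mat m n → Mat n m
(M ᵀ) i j = M j i

δ : ∀ {n} → Fin n → Fin n → ℤ
δ i j = if does (i ≟ j) then + 1 else + 0

Id : ∀ n → SqMat n
Id n = δ

J : ∀ m n → Mat m n
J m n i j = + 1

_·_ : ∀ {m n} → ℤ → Mat m n → Mat m n
(c · M) i j = c * M i j

_⊖_ : ∀ {m n} → Mat m n → Mat m n → Mat m n
(M ⊖ N) i j = M i j - N i j

_≈_ : ∀ {m n} → Mat m n → Mat m n → Set
M ≈ N = ∀ i j → M i j ≡ N i j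

infix 4 _≈_

_^^_ : ∀ {n} → SqMat n → ℕ → SqMat n
M ^^ zero  = Id _
M ^^ suc m = M ⊗ (M ^^ m)

IsZeroMat : ∀ {m n} → Mat m n → Set
IsZeroMat M = ∀ i j → M i j ≡ + 0

IsSignedPerm : ∀ {n} → SqMat n → Set
IsSignedPerm {n} M =
  Σ (Permutation′ n) λ σ → Σ (Fin n → ℤ) λ ε →
    (∀ i → ε i ≡ + 1 ⊎ ε i ≡ - (+ 1)) ×
    (∀ i j → M i j ≡ (if does (j ≟ (σ ⟨$⟩ʳ i)) then ε i else + 0))

-- The dihedral group D_{2k}, elements x^a y^s encoded as (s , a),
-- listed as x^0,…,x^{k-1},y,xy,…,x^{k-1}y  (index s*k + a).

addMod : ∀ {k} → Fin k → Fin k → Fin k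
addMod {suc k} a b = (toℕ a ℕ.+ toℕ b) mod suc k

negMod : ∀ {k} → Fin k → Fin k
negMod {suc k} b = (suc k ∸ toℕ b) mod suc k

xor2 : Fin 2 → Fin 2 → Fin 2
xor2 zero t = t
xor2 (suc zero) zero = suc zero
xor2 (suc zero) (suc zero) = zero

-- (x^a y^s)(x^b y^t) = x^(a + (-1)^s b) y^(s+t), using y x = x^{-1} y
dmul : ∀ {k} → Fin 2 × Fin k → Fin 2 × Fin k → Fin 2 × Fin k
dmul (zero , a)     (t , b) = (t , addMod a b)
dmul (suc zero , a) (t , b) = (xor2 (suc zero) t , addMod a (negMod b))

dec : ∀ k → Fin (2 ℕ.* k) → Fin 2 × Fin k
dec k i = remQuot {2} k i

enc : ∀ k → Fin 2 × Fin k → Fin (2 ℕ.* k)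
enc k (s , a) = combine {2} {k} s a

Dmul : ∀ k → Fin (2 ℕ.* k) → Fin (2 ℕ.* k) → Fin (2 ℕ.* k)
Dmul k u g = enc k (dmul (dec k u) (dec k g))

ρ : ∀ k → Fin (2 ℕ.* k) → SqMat (2 ℕ.* k)
ρ k g u v = δ (Dmul k u g) v

-- elements of Z D_{2k} with 0/1 coefficients, and linear extension of ρ
ZD01 : ℕ → Set
ZD01 k = Fin (2 ℕ.* k) → Bool

ρZ : ∀ k → ZD01 k → SqMat (2 ℕ.* k)
ρZ k w u v = ∑ (λ g → (if w g then + 1 else + 0) * ρ k g u v)

pm : ∀ k → ZD01 k → SqMat (2 ℕ.* k)
pm k w = ((+ 2) · ρZ k w) ⊖ J (2 ℕ.* k) (2 ℕ.* k)

N : ℕ → ℕ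
N k = 4 ℕ.+ 4 ℕ.* (2 ℕ.* k)

view : ∀ k → Fin (N k) → Fin 4 ⊎ (Fin 4 × Fin (2 ℕ.* k))
view k i with splitAt 4 {4 ℕ.* (2 ℕ.* k)} i
... | inj₁ r = inj₁ r
... | inj₂ x = inj₂ (remQuot {4} (2 ℕ.* k) x)

one mone : ℤ
one = + 1
mone = - (+ 1)

tl : Fin 4 → Fin 4 → ℤ
tl zero _ = one
tl (suc zero) zero = one
tl (suc zero) (suc zero) = one
tl (suc zero) (suc (suc _)) = mone
tl (suc (suc zero)) zero = one
tl (suc (suc zero)) (suc zero) = mone
tl (suc (suc zero)) (suc (suc zero)) = one
tl (suc (suc zero)) (suc (suc (suc zero))) = mone
tl (suc (suc (suc zero))) zero = one
tl (suc (suc (suc zero))) (suc zero) = mone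
tl (suc (suc (suc zero))) (suc (suc zero)) = mone
tl (suc (suc (suc zero))) (suc (suc (suc zero))) = one

-- signs of the all-ones row blocks (top-right), row r, block column c
tr : Fin 4 → Fin 4 → ℤ
tr zero _ = one
tr (suc zero) zero = one
tr (suc zero) (suc zero) = one
tr (suc zero) (suc (suc _)) = mone
tr (suc (suc zero)) zero = one
tr (suc (suc zero)) (suc zero) = mone
tr (suc (suc zero)) (suc (suc zero)) = one
tr (suc (suc zero)) (suc (suc (suc zero))) = mone
tr (suc (suc (suc zero))) zero = mone
tr (suc (suc (suc zero))) (suc zero) = one
tr (suc (suc (suc zero))) (suc (suc zero)) = one
tr (suc (suc (suc zero))) (suc (suc (suc zero))) = mone

-- signs of the all-ones column blocks (bottom-left), block row b, column c
bl : Fin 4 → Fin 4 → ℤ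
bl zero (suc (suc (suc zero))) = mone
bl zero _ = one
bl (suc zero) (suc (suc zero)) = mone
bl (suc zero) _ = one
bl (suc (suc zero)) (suc zero) = mone
bl (suc (suc zero)) _ = one
bl (suc (suc (suc zero))) zero = one
bl (suc (suc (suc zero))) _ = mone

-- bottom-right: block (b , c) = sign * X, X ∈ {A,B,C,D} (labels 0..3)
brLabel : Fin 4 → Fin 4 → Fin 4
brLabel zero c = c
brLabel (suc zero) zero = suc zero
brLabel (suc zero) (suc zero) = zero
brLabel (suc zero) (suc (suc zero)) = suc (suc (suc zero))
brLabel (suc zero) (suc (suc (suc zero))) = suc (suc zero)
brLabel (suc (suc zero)) zero = suc (suc zero)
brLabel (suc (suc zero)) (suc zero) = suc (suc (suc zero))
brLabel (suc (suc zero)) (suc (suc zero)) = zero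
brLabel (suc (suc zero)) (suc (suc (suc zero))) = suc zero
brLabel (suc (suc (suc zero))) zero = suc (suc (suc zero))
brLabel (suc (suc (suc zero))) (suc zero) = suc (suc zero)
brLabel (suc (suc (suc zero))) (suc (suc zero)) = suc zero
brLabel (suc (suc (suc zero))) (suc (suc (suc zero))) = zero

brSign : Fin 4 → Fin 4 → ℤ
brSign zero _ = one
brSign (suc zero) zero = mone
brSign (suc zero) (suc (suc (suc zero))) = mone
brSign (suc zero) _ = one
brSign (suc (suc zero)) zero = mone
brSign (suc (suc zero)) (suc zero) = mone
brSign (suc (suc zero)) _ = one
brSign (suc (suc (suc zero))) (suc zero) = mone
brSign (suc (suc (suc zero))) (suc (suc (suc zero))) = mone
brSign (suc (suc (suc zero))) _ = one

pick : ∀ {A : Set} → Fin 4 → A → A → A → A → A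
pick zero a b c d = a
pick (suc zero) a b c d = b
pick (suc (suc zero)) a b c d = c
pick (suc (suc (suc zero))) a b c d = d

Kimura : ∀ k → (a b c d : ZD01 k) → SqMat (N k)
Kimura k a b c d i j with view k i | view k j
... | inj₁ r | inj₁ s = tl r s
... | inj₁ r | inj₂ (c' , _) = tr r c'
... | inj₂ (b' , _) | inj₁ s = bl b' s
... | inj₂ (b' , u) | inj₂ (c' , v) =
  brSign b' c' * pick (brLabel b' c') (pm k a) (pm k b) (pm k c) (pm k d) u v

IsHadamard : ∀ {n} → SqMat n → Set
IsHadamard {n} H = H ⊗ (H ᵀ) ≈ (+ n) · Id n

IsKimuraHadamard : ∀ k → SqMat (N k) → Set
IsKimuraHadamard k H =
  Σ (ZD01 k) λ a → Σ (ZD01 k) λ b → Σ (ZD01 k) λ c → Σ (ZD01 k) λ d →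
    (H ≈ Kimura k a b c d) × IsHadamard H

InAut : ∀ {n} → SqMat n → SqMat n × SqMat n → Set
InAut H (R , S) = IsSignedPerm R × IsSignedPerm S × (R ⊗ H ⊗ (S ᵀ) ≈ H)

_≈₂_ : ∀ {n} → SqMat n × SqMat n → SqMat n × SqMat n → Set
(R , S) ≈₂ (R' , S') = (R ≈ R') × (S ≈ S')

-- |Aut(H)| = m : an enumeration Fin m → Aut(H) that is injective and
-- surjective (up to matrix equality)
AutCard : ∀ {n} → SqMat n → ℕ → Set
AutCard {n} H m =
  Σ (Fin m → SqMat n × SqMat n) λ f →
    (∀ i → InAut H (f i)) ×
    (∀ i j → f i ≈₂ f j → i ≡ j) ×
    (∀ g → InAut H g → Σ (Fin m) λ i → g ≈₂ f i)

pow₂ : ∀ {n} → SqMat n × SqMat n → ℕ → SqMat n × SqMat n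
pow₂ (R , S) m = (R ^^ m , S ^^ m)

HasOrder : ∀ {n} → SqMat n × SqMat n → ℕ → Set
HasOrder {n} g m =
  (0 ℕ.< m) × (pow₂ g m ≈₂ (Id n , Id n)) ×
  (∀ j → 0 ℕ.< j → j ℕ.< m → ¬ (pow₂ g j ≈₂ (Id n , Id n)))

top : ∀ k → Fin 4 → Fin (N k)
top k r = join 4 (4 ℕ.* (2 ℕ.* k)) (inj₁ r)

blk : ∀ k → Fin 4 → Fin (2 ℕ.* k) → Fin (N k)
blk k b u = join 4 (4 ℕ.* (2 ℕ.* k)) (inj₂ (combine {4} {2 ℕ.* k} b u))

sub : ∀ k → Fin 4 → Fin 2 → Fin k → Fin (N k)
sub k b s r = blk k b (combine {2} {k} s r)

Block : ∀ k → SqMat (N k) → Fin 4 → Fin 4 → SqMat (2 ℕ.* k)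
Block k M b b' u v = M (blk k b u) (blk k b' v)

SubBlock : ∀ k → SqMat (2 ℕ.* k) → Fin 2 → Fin 2 → SqMat k
SubBlock k X s s' r t = X (combine {2} {k} s r) (combine {2} {k} s' t)

NonZeroMat : ∀ {m n} → Mat m n → Set
NonZeroMat M = ¬ IsZeroMat M

ExactlyOneNZ : ∀ {m a b} → (Fin m → Fin m → Mat a b) → Set
ExactlyOneNZ {m} X =
  (∀ i → Σ (Fin m) λ j → NonZeroMat (X i j) × (∀ j' → NonZeroMat (X i j') → j' ≡ j)) ×
  (∀ j → Σ (Fin m) λ i → NonZeroMat (X i j) × (∀ i' → NonZeroMat (X i' j) → i' ≡ i))

IsDiag4 : ∀ k → SqMat (N k) → Set
IsDiag4 k M =
  (∀ r b u → M (top k r) (blk k b u) ≡ + 0) × (∀ r b u → M (blk k b u) (top k r) ≡ + 0)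

BlockMonomial : ∀ k → SqMat (N k) → Set
BlockMonomial k M =
  IsDiag4 k M ×
  IsSignedPerm (λ r s → M (top k r) (top k s)) ×
  ExactlyOneNZ (Block k M) ×
  (∀ b b' → NonZeroMat (Block k M b b') →
     ExactlyOneNZ (SubBlock k (Block k M b b')) ×
     (∀ s s' → NonZeroMat (SubBlock k (Block k M b b') s s') →
        IsSignedPerm (SubBlock k (Block k M b b') s s')))

-- M = diag(I₄ , M₁ , … , M₈) with each Mᵢ a k×k signed permutation matrix;
-- the eight k×k diagonal blocks are indexed by (b , s) ∈ Fin 4 × Fin 2
IsDiagI4Signed : ∀ k → SqMat (N k) → Set
IsDiagI4Signed k M =
  (∀ r r' → M (top k r) (top k r') ≡ δ r r') ×
  IsDiag4 k M ×
  (∀ b s b' s' → ¬ ((b , s) ≡ (b' , s')) →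
     ∀ (r t : Fin k) → M (sub k b s r) (sub k b' s' t) ≡ + 0) ×
  (∀ b s → IsSignedPerm (λ (r t : Fin k) → M (sub k b s r) (sub k b s t)))

{-# OPTIONS --safe #-}
module Submission where

-- Write R as a monomial matrix, R i j = ε i · δ (s i) j; then Rᵖ = I says sᵖ = id and that the
-- signs along every s-orbit multiply to 1.  Block monomial form means that s permutes the four
-- leading indices, the four blocks and, inside a block it preserves, the two sub-blocks.  Each of
-- these induced permutations moves at most 4 < p objects yet has order dividing p, so it is the
-- identity: a point of period p that also has a period c ≤ 4 is fixed, since gcd (c , p) = 1.
-- On a leading index, now fixed by s, the sign ε satisfies ε² = εᵖ = 1, hence ε = 1 as p is odd.
-- Only R ∈ Aut(H) being signed, block monomial and of order p is used.

open import Defs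
open import Data.Bool using (if_then_else_)
open import Data.Empty using (⊥-elim)
open import Data.Fin as Fin using (Fin; zero; suc; toℕ; _≟_; _↑ʳ_; splitAt; combine)
open import Data.Fin.Permutation using (_⟨$⟩ʳ_)
open import Data.Fin.Properties
  using ( pigeonhole; toℕ<n; suc-injective; ↑ˡ-injective; ↑ʳ-injective
        ; splitAt⁻¹-↑ˡ; splitAt⁻¹-↑ʳ
        ; combine-injective; combine-surjective )
open import Data.Integer using (ℤ; +_; -_; _*_; _+_)
import Data.Integer.Properties as ℤ
open import Data.Nat as ℕ using (ℕ; zero; suc; _∸_; _≤_; _<_; _%_; z≤n; s≤s)
open import Data.Nat.Divisibility using (_∣_)
import Data.Nat.Properties as ℕ
open import Data.Nat.Coprimality using (Coprime; coprime-Bézout; prime⇒coprime)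
open import Data.Nat.GCD using (module Bézout)
open import Data.Nat.GeneralisedArithmetic using (iterate)
open import Data.Nat.Primality using (Prime; composite[4]; composite⇒¬prime)
open import Data.Product using (Σ; ∃; ∃₂; _×_; _,_; proj₁; proj₂)
open import Data.Sum using (_⊎_; inj₁; inj₂)
open import Data.Unit using (⊤; tt)
open import Function.Base using (id; _∘_)
open import Relation.Nullary using (¬_; does; yes; no)
open import Relation.Binary.PropositionalEquality
open ≡-Reasoning

module _ {A : Set} (f : A → A) where

  iterate-+ : ∀ x m n → iterate f x (m ℕ.+ n) ≡ iterate f (iterate f x m) n
  iterate-+ x zero    n = refl
  iterate-+ x (suc m) n = iterate-+ (f x) m n

  iterate-comm : ∀ x m n → iterate f (iterate f x m) n ≡ iterate f (iterate f x n) m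
  iterate-comm x m n = begin
    iterate f (iterate f x m) n  ≡⟨ iterate-+ x m n ⟨
    iterate f x (m ℕ.+ n)        ≡⟨ cong (iterate f x) (ℕ.+-comm m n) ⟩
    iterate f x (n ℕ.+ m)        ≡⟨ iterate-+ x n m ⟩
    iterate f (iterate f x n) m  ∎

  Periodic : A → ℕ → Set
  Periodic x m = iterate f x m ≡ x

  fixed⇒periodic : ∀ {x} → f x ≡ x → ∀ m → Periodic x m
  fixed⇒periodic fx zero    = refl
  fixed⇒periodic fx (suc m) = trans (cong (λ y → iterate f y m) fx) (fixed⇒periodic fx m)

  periodic-* : ∀ {x m} → Periodic x m → ∀ q → Periodic x (q ℕ.* m)
  periodic-* _  zero    = refl
  periodic-* {x} {m} px (suc q) = begin
    iterate f x (m ℕ.+ q ℕ.* m)        ≡⟨ iterate-+ x m (q ℕ.* m) ⟩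
    iterate f (iterate f x m) (q ℕ.* m) ≡⟨ cong (λ y → iterate f y (q ℕ.* m)) px ⟩
    iterate f x (q ℕ.* m)              ≡⟨ periodic-* px q ⟩
    x                                  ∎

  periodic-+-cancelʳ : ∀ {x m d} → Periodic x m → Periodic x (d ℕ.+ m) → Periodic x d
  periodic-+-cancelʳ {x} {m} {d} px pdm = begin
    iterate f x d                ≡⟨ cong (λ y → iterate f y d) px ⟨
    iterate f (iterate f x m) d  ≡⟨ iterate-+ x m d ⟨
    iterate f x (m ℕ.+ d)        ≡⟨ cong (iterate f x) (ℕ.+-comm m d) ⟩
    iterate f x (d ℕ.+ m)        ≡⟨ pdm ⟩
    x                            ∎

  periodic-bézout : ∀ {x d m n} → Periodic x m → Periodic x n → Bézout.Identity d m n →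
                    Periodic x d
  periodic-bézout {x} {d} {m} {n} pm pn (Bézout.+- a b eq) =
    periodic-+-cancelʳ {x} {b ℕ.* n} {d} (periodic-* {x} {n} pn b)
      (subst (Periodic x) (sym eq) (periodic-* {x} {m} pm a))
  periodic-bézout {x} {d} {m} {n} pm pn (Bézout.-+ a b eq) =
    periodic-+-cancelʳ {x} {a ℕ.* m} {d} (periodic-* {x} {m} pm a)
      (subst (Periodic x) (sym eq) (periodic-* {x} {n} pn b))

  coprime-periods⇒fixed : ∀ {x m n} → Coprime m n → Periodic x m → Periodic x n → f x ≡ x
  coprime-periods⇒fixed c pm pn = periodic-bézout pm pn (coprime-Bézout c)

-- Pigeonhole gives a point y = fⁱ x of period c ≤ n < p; being coprime to p, c forces f y = y,
-- and then x = fᵖ x = y.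
prime-periodic⇒fixed : ∀ {n p} (f : Fin n → Fin n) → Prime p → n < p →
                       ∀ {x} → Periodic f x p → f x ≡ x
prime-periodic⇒fixed {n} {p} f p-prime n<p {x} px
  with i , j , i<j , fⁱx≡fʲx ← pigeonhole ℕ.≤-refl (λ (i : Fin (suc n)) → iterate f x (toℕ i))
  = subst (λ z → f z ≡ z) (sym x≡y) fy≡y
  where
  y = iterate f x (toℕ i)
  c = toℕ j ∸ toℕ i

  j<p : toℕ j < p
  j<p = ℕ.≤-trans (toℕ<n j) n<p

  y-periodic-c : Periodic f y c
  y-periodic-c = begin
    iterate f y c                ≡⟨ iterate-+ f x (toℕ i) c ⟨
    iterate f x (toℕ i ℕ.+ c)    ≡⟨ cong (iterate f x) (ℕ.m+[n∸m]≡n (ℕ.<⇒≤ i<j)) ⟩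
    iterate f x (toℕ j)          ≡⟨ fⁱx≡fʲx ⟨
    y                            ∎

  y-periodic-p : Periodic f y p
  y-periodic-p = trans (iterate-comm f x (toℕ i) p) (cong (λ z → iterate f z (toℕ i)) px)

  p⊥c : Coprime p c
  p⊥c = prime⇒coprime p-prime {{ℕ.>-nonZero (ℕ.m<n⇒0<n∸m i<j)}}
          (ℕ.≤-<-trans (ℕ.m∸n≤m (toℕ j) (toℕ i)) j<p)

  i≤p : toℕ i ≤ p
  i≤p = ℕ.<⇒≤ (ℕ.<-trans i<j j<p)

  fy≡y : f y ≡ y
  fy≡y = coprime-periods⇒fixed f p⊥c y-periodic-p y-periodic-c

  x≡y : x ≡ y
  x≡y = begin
    x                                   ≡⟨ px ⟨
    iterate f x p                       ≡⟨ cong (iterate f x) (ℕ.m+[n∸m]≡n i≤p) ⟨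
    iterate f x (toℕ i ℕ.+ (p ∸ toℕ i)) ≡⟨ iterate-+ f x (toℕ i) (p ∸ toℕ i) ⟩
    iterate f y (p ∸ toℕ i)             ≡⟨ fixed⇒periodic f fy≡y (p ∸ toℕ i) ⟩
    y                                   ∎

δ-refl : ∀ {n} (i : Fin n) → δ i i ≡ + 1
δ-refl i with i ≟ i
... | yes _   = refl
... | no i≢i  = ⊥-elim (i≢i refl)

δ-≢ : ∀ {n} {i j : Fin n} → i ≢ j → δ i j ≡ + 0
δ-≢ {i = i} {j} i≢j with i ≟ j
... | yes i≡j = ⊥-elim (i≢j i≡j)
... | no _    = refl

δ≢0⇒≡ : ∀ {n} {i j : Fin n} → δ i j ≢ + 0 → i ≡ j
δ≢0⇒≡ {i = i} {j} δ≢0 with i ≟ j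
... | yes i≡j = i≡j
... | no _    = ⊥-elim (δ≢0 refl)

δ-reindex : ∀ {m n} (g : Fin m → Fin n) → (∀ {i j} → g i ≡ g j → i ≡ j) →
            ∀ i j → δ (g i) (g j) ≡ δ i j
δ-reindex g g-inj i j with i ≟ j
... | yes refl = δ-refl (g i)
... | no i≢j   = δ-≢ (i≢j ∘ g-inj)

∑-zero : ∀ {n} {f : Fin n → ℤ} → (∀ i → f i ≡ + 0) → ∑ f ≡ + 0
∑-zero {zero}  f≡0 = refl
∑-zero {suc n} f≡0 = cong₂ _+_ (f≡0 zero) (∑-zero (f≡0 ∘ suc))

∑-single : ∀ {n} (a : Fin n) {f : Fin n → ℤ} → (∀ i → i ≢ a → f i ≡ + 0) → ∑ f ≡ f a
∑-single zero    {f} f≡0 = begin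
  f zero + ∑ (f ∘ suc)  ≡⟨ cong (_+_ (f zero)) (∑-zero (λ i → f≡0 (suc i) λ ())) ⟩
  f zero + + 0          ≡⟨ ℤ.+-identityʳ (f zero) ⟩
  f zero                ∎
∑-single (suc a) {f} f≡0 = begin
  f zero + ∑ (f ∘ suc)  ≡⟨ cong (_+ ∑ (f ∘ suc)) (f≡0 zero λ ()) ⟩
  + 0 + ∑ (f ∘ suc)     ≡⟨ ℤ.+-identityˡ _ ⟩
  ∑ (f ∘ suc)           ≡⟨ ∑-single a (λ i i≢a → f≡0 (suc i) (i≢a ∘ suc-injective)) ⟩
  f (suc a)             ∎

±1≢0 : ∀ {e} → e ≡ + 1 ⊎ e ≡ - (+ 1) → e ≢ + 0
±1≢0 (inj₁ refl) ()
±1≢0 (inj₂ refl) ()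

record Monomial {n} (s : Fin n → Fin n) (ε : Fin n → ℤ) (M : SqMat n) : Set where
  constructor monomial
  field entries : ∀ i j → M i j ≡ ε i * δ (s i) j

signedPermEntries⇒monomial : ∀ {n} {s : Fin n → Fin n} {ε : Fin n → ℤ} {M : SqMat n} →
  (∀ i j → M i j ≡ (if does (j ≟ s i) then ε i else + 0)) → Monomial s ε M
signedPermEntries⇒monomial {s = s} {ε} {M} entries = monomial entry
  where
  entry : ∀ i j → M i j ≡ ε i * δ (s i) j
  entry i j with j ≟ s i | s i ≟ j | entries i j
  ... | yes _    | yes _    | Mij = trans Mij (sym (ℤ.*-identityʳ (ε i)))
  ... | no _     | no _     | Mij = trans Mij (sym (ℤ.*-zeroʳ (ε i)))
  ... | yes j≡si | no si≢j  | _   = ⊥-elim (si≢j (sym j≡si))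
  ... | no j≢si  | yes si≡j | _   = ⊥-elim (j≢si (sym si≡j))

module _ {n} {s : Fin n → Fin n} {ε : Fin n → ℤ} {M : SqMat n} (mono : Monomial s ε M) where

  open Monomial mono

  monomial-graph : ∀ i → M i (s i) ≡ ε i
  monomial-graph i =
    trans (entries i (s i)) (trans (cong (ε i *_) (δ-refl (s i))) (ℤ.*-identityʳ (ε i)))

  monomial-off-graph : ∀ {i j} → s i ≢ j → M i j ≡ + 0
  monomial-off-graph {i} {j} si≢j =
    trans (entries i j) (trans (cong (ε i *_) (δ-≢ si≢j)) (ℤ.*-zeroʳ (ε i)))

  monomial-support : ∀ {i j} → M i j ≢ + 0 → s i ≡ j
  monomial-support {i} {j} Mij≢0 = δ≢0⇒≡ λ δ≡0 →
    Mij≢0 (trans (entries i j) (trans (cong (ε i *_) δ≡0) (ℤ.*-zeroʳ (ε i))))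

orbitSign : ∀ {n} → (Fin n → Fin n) → (Fin n → ℤ) → ℕ → Fin n → ℤ
orbitSign s ε zero    i = + 1
orbitSign s ε (suc m) i = ε i * orbitSign s ε m (s i)

monomial-^^ : ∀ {n} {s : Fin n → Fin n} {ε : Fin n → ℤ} {M : SqMat n} → Monomial s ε M →
              ∀ m → Monomial (λ i → iterate s i m) (orbitSign s ε m) (M ^^ m)
monomial-^^ mono zero    = monomial λ i j → sym (ℤ.*-identityˡ (δ i j))
monomial-^^ {s = s} {ε} {M} mono (suc m) = monomial entry
  where
  entry : ∀ i j → (M ^^ suc m) i j ≡ orbitSign s ε (suc m) i * δ (iterate s i (suc m)) j
  entry i j = begin
    ∑ (λ l → M i l * (M ^^ m) l j)
      ≡⟨ ∑-single (s i) (λ l l≢si → trans (cong (_* (M ^^ m) l j) (monomial-off-graph mono (l≢si ∘ sym)))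
                                          (ℤ.*-zeroˡ ((M ^^ m) l j))) ⟩
    M i (s i) * (M ^^ m) (s i) j
      ≡⟨ cong₂ _*_ (monomial-graph mono i) (Monomial.entries (monomial-^^ mono m) (s i) j) ⟩
    ε i * (orbitSign s ε m (s i) * δ (iterate s (s i) m) j)
      ≡⟨ ℤ.*-assoc (ε i) _ _ ⟨
    ε i * orbitSign s ε m (s i) * δ (iterate s (s i) m) j
      ∎

monomial≈Id : ∀ {n} {s : Fin n → Fin n} {ε : Fin n → ℤ} {M : SqMat n} → Monomial s ε M →
              M ≈ Id n → ∀ i → s i ≡ i × ε i ≡ + 1
monomial≈Id {s = s} {ε} {M} mono M≈I i = si≡i , (begin
  ε i        ≡⟨ monomial-graph mono i ⟨
  M i (s i)  ≡⟨ cong (M i) si≡i ⟩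
  M i i      ≡⟨ Mii≡1 ⟩
  + 1        ∎)
  where
  Mii≡1 : M i i ≡ + 1
  Mii≡1 = trans (M≈I i i) (δ-refl i)
  si≡i : s i ≡ i
  si≡i = monomial-support mono λ Mii≡0 → ±1≢0 (inj₁ refl) (trans (sym Mii≡1) Mii≡0)

orbitSign-fixed : ∀ {n} {s : Fin n → Fin n} {ε : Fin n → ℤ} {i} → s i ≡ i →
                  ∀ m → orbitSign s ε m i ≡ iterate (ε i *_) (+ 1) m
orbitSign-fixed si≡i zero = refl
orbitSign-fixed {s = s} {ε} {i} si≡i (suc m) = begin
  ε i * orbitSign s ε m (s i)      ≡⟨ cong (λ j → ε i * orbitSign s ε m j) si≡i ⟩
  ε i * orbitSign s ε m i          ≡⟨ cong (ε i *_) (orbitSign-fixed si≡i m) ⟩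
  ε i * iterate (ε i *_) (+ 1) m   ≡⟨ iterate-comm (ε i *_) (+ 1) 1 m ⟨
  iterate (ε i *_) (ε i * + 1) m   ∎

±1-periodic-prime⇒≡1 : ∀ {e p} → e ≡ + 1 ⊎ e ≡ - (+ 1) → Prime p → 2 < p →
                        Periodic (e *_) (+ 1) p → e ≡ + 1
±1-periodic-prime⇒≡1 {e} e±1 p-prime 2<p periodic-p =
  trans (sym (ℤ.*-identityʳ e))
        (coprime-periods⇒fixed (e *_) (prime⇒coprime p-prime 2<p) periodic-p (periodic-2 e±1))
  where
  periodic-2 : ∀ {e} → e ≡ + 1 ⊎ e ≡ - (+ 1) → Periodic (e *_) (+ 1) 2
  periodic-2 (inj₁ refl) = refl
  periodic-2 (inj₂ refl) = refl

top-injective : ∀ k {r r′} → top k r ≡ top k r′ → r ≡ r′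
top-injective k = ↑ˡ-injective _ _ _

blk-injective : ∀ k {b u b′ u′} → blk k b u ≡ blk k b′ u′ → b ≡ b′ × u ≡ u′
blk-injective k = combine-injective _ _ _ _ ∘ ↑ʳ-injective 4 _ _

sub-injective : ∀ k {b x r b′ x′ r′} →
                sub k b x r ≡ sub k b′ x′ r′ → (b , x) ≡ (b′ , x′)
sub-injective k {b} {x} {r} {b′} {x′} {r′} e =
  cong₂ _,_ (proj₁ b≡b′×u≡u′) (proj₁ (combine-injective x r x′ r′ (proj₂ b≡b′×u≡u′)))
  where b≡b′×u≡u′ = blk-injective k {b} {combine x r} {b′} {combine x′ r′} e

top-or-blk : ∀ k (i : Fin (N k)) → (∃ λ r → top k r ≡ i) ⊎ (∃₂ λ b u → blk k b u ≡ i)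
top-or-blk k i with splitAt 4 i in eq
... | inj₁ r = inj₁ (r , splitAt⁻¹-↑ˡ eq)
... | inj₂ x with b , u , bu≡x ← combine-surjective {4} x =
  inj₂ (b , u , trans (cong (4 ↑ʳ_) bu≡x) (splitAt⁻¹-↑ʳ eq))

MapsFibres : ∀ {A B C : Set} → (A → A) → (B → C → A) → (B → B) → Set
MapsFibres {C = C} s enc t = ∀ b c → ∃ λ (c′ : C) → s (enc b c) ≡ enc (t b) c′

mapsFibres-iterate : ∀ {A B C : Set} {s : A → A} {enc : B → C → A} {t : B → B} →
  MapsFibres s enc t → ∀ q → MapsFibres (λ a → iterate s a q) enc (λ b → iterate t b q)
mapsFibres-iterate s-maps zero    b c = c , refl
mapsFibres-iterate {s = s} {enc} {t} s-maps (suc q) b c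
  with c′ , e ← s-maps b c
  with c″ , e′ ← mapsFibres-iterate {s = s} {enc} {t} s-maps q (t b) c′ =
    c″ , trans (cong (λ a → iterate s a q) e) e′

mapsFibres-prime⇒id : ∀ {A C : Set} {m p} {s : A → A} {enc : Fin m → C → A} {t : Fin m → Fin m} →
  Prime p → m < p → (∀ a → Periodic s a p) →
  (∀ {b c b′ c′} → enc b c ≡ enc b′ c′ → b ≡ b′) →
  MapsFibres s enc t → MapsFibres s enc id
mapsFibres-prime⇒id {p = p} {s = s} {enc} {t} p-prime m<p s-periodic enc-injective s-maps b c
  with c′ , e ← s-maps b c = c′ , trans e (cong (λ b′ → enc b′ c′) tb≡b)
  where
  t-periodic : Periodic t b p
  t-periodic with c″ , e′ ← mapsFibres-iterate {s = s} {enc} {t} s-maps p b c =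
    sym (enc-injective (trans (sym (s-periodic (enc b c))) e′))
  tb≡b : t b ≡ b
  tb≡b = prime-periodic⇒fixed t p-prime m<p t-periodic

entry≢0⇒nonZero : ∀ {m n} {X : Mat m n} {i j} → X i j ≢ + 0 → NonZeroMat X
entry≢0⇒nonZero {i = i} {j} Xij≢0 X≡0 = Xij≢0 (X≡0 i j)

module PrimeOrderBlockMonomial
  {k p} (p-prime : Prime p) (4<p : 4 < p)
  {M : SqMat (N k)} {s : Fin (N k) → Fin (N k)} {ε : Fin (N k) → ℤ}
  (ε±1 : ∀ i → ε i ≡ + 1 ⊎ ε i ≡ - (+ 1)) (mono : Monomial s ε M)
  (M^p≈I : M ^^ p ≈ Id (N k)) (blockMonomial : BlockMonomial k M) where

  2<p : 2 < p
  2<p = ℕ.≤-trans (s≤s (s≤s (s≤s z≤n))) (ℕ.<⇒≤ 4<p)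

  diag4 : IsDiag4 k M
  diag4 = proj₁ blockMonomial

  topLeft : IsSignedPerm (λ r r′ → M (top k r) (top k r′))
  topLeft = proj₁ (proj₂ blockMonomial)

  blocks : ExactlyOneNZ (Block k M)
  blocks = proj₁ (proj₂ (proj₂ blockMonomial))

  subBlocks : ∀ b → NonZeroMat (Block k M b b) → ExactlyOneNZ (SubBlock k (Block k M b b))
  subBlocks b nz = proj₁ (proj₂ (proj₂ (proj₂ blockMonomial)) b b nz)

  diagonalSubBlocks-signedPerm : ∀ b (nz : NonZeroMat (Block k M b b)) x →
    NonZeroMat (SubBlock k (Block k M b b) x x) → IsSignedPerm (SubBlock k (Block k M b b) x x)
  diagonalSubBlocks-signedPerm b nz x = proj₂ (proj₂ (proj₂ (proj₂ blockMonomial)) b b nz) x x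

  M^p-trivial : ∀ i → iterate s i p ≡ i × orbitSign s ε p i ≡ + 1
  M^p-trivial = monomial≈Id (monomial-^^ mono p) M^p≈I

  s-periodic : ∀ i → Periodic s i p
  s-periodic i = proj₁ (M^p-trivial i)

  graph-nonzero : ∀ {i j} → s i ≡ j → M i j ≢ + 0
  graph-nonzero {i} refl Mij≡0 = ±1≢0 (ε±1 i) (trans (sym (monomial-graph mono i)) Mij≡0)

  τ : Fin 4 → Fin 4
  τ = proj₁ topLeft ⟨$⟩ʳ_

  topLeft-monomial : Monomial τ (proj₁ (proj₂ topLeft)) (λ r r′ → M (top k r) (top k r′))
  topLeft-monomial = signedPermEntries⇒monomial (proj₂ (proj₂ (proj₂ topLeft)))

  s-maps-top : MapsFibres s (λ r (_ : ⊤) → top k r) τ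
  s-maps-top r _ with top-or-blk k (s (top k r))
  ... | inj₁ (r′ , e) =
    tt , trans (sym e) (cong (top k) (sym (monomial-support topLeft-monomial (graph-nonzero (sym e)))))
  ... | inj₂ (b , u , e) = ⊥-elim (graph-nonzero (sym e) (proj₁ diag4 r b u))

  s-top : ∀ r → s (top k r) ≡ top k r
  s-top r = proj₂ (mapsFibres-prime⇒id {enc = λ r _ → top k r} {τ}
                     p-prime 4<p s-periodic (top-injective k) s-maps-top r tt)

  ε-top : ∀ r → ε (top k r) ≡ + 1
  ε-top r = ±1-periodic-prime⇒≡1 (ε±1 (top k r)) p-prime 2<p
    (trans (sym (orbitSign-fixed (s-top r) p)) (proj₂ (M^p-trivial (top k r))))

  topLeft-identity : ∀ r r′ → M (top k r) (top k r′) ≡ δ r r′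
  topLeft-identity r r′ = begin
    M (top k r) (top k r′)                     ≡⟨ Monomial.entries mono (top k r) (top k r′) ⟩
    ε (top k r) * δ (s (top k r)) (top k r′)   ≡⟨ cong₂ (λ e i → e * δ i (top k r′)) (ε-top r) (s-top r) ⟩
    + 1 * δ (top k r) (top k r′)               ≡⟨ ℤ.*-identityˡ _ ⟩
    δ (top k r) (top k r′)                     ≡⟨ δ-reindex (top k) (top-injective k) r r′ ⟩
    δ r r′                                     ∎

  π : Fin 4 → Fin 4
  π b = proj₁ (proj₁ blocks b)

  π-unique : ∀ {b b′} → NonZeroMat (Block k M b b′) → b′ ≡ π b
  π-unique {b} {b′} = proj₂ (proj₂ (proj₁ blocks b)) b′

  s-maps-blk : MapsFibres s (blk k) π
  s-maps-blk b u with top-or-blk k (s (blk k b u))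
  ... | inj₁ (r , e) = ⊥-elim (graph-nonzero (sym e) (proj₂ diag4 r b u))
  ... | inj₂ (b′ , v , e) =
    v , trans (sym e) (cong (λ b″ → blk k b″ v) (π-unique {b} {b′} nz))
    where
    nz : NonZeroMat (Block k M b b′)
    nz = entry≢0⇒nonZero {i = u} {v} (graph-nonzero (sym e))

  s-blk : MapsFibres s (blk k) id
  s-blk = mapsFibres-prime⇒id {enc = blk k} {π}
            p-prime 4<p s-periodic (proj₁ ∘ blk-injective k) s-maps-blk

  module WithinBlock (b : Fin 4) (u₀ : Fin (2 ℕ.* k)) where

    diagonalBlock-nonzero : NonZeroMat (Block k M b b)
    diagonalBlock-nonzero =
      entry≢0⇒nonZero {i = u₀} {proj₁ (s-blk b u₀)} (graph-nonzero (proj₂ (s-blk b u₀)))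

    θ : Fin 2 → Fin 2
    θ x = proj₁ (proj₁ (subBlocks b diagonalBlock-nonzero) x)

    θ-unique : ∀ {x x′} → NonZeroMat (SubBlock k (Block k M b b) x x′) → x′ ≡ θ x
    θ-unique {x} {x′} = proj₂ (proj₂ (proj₁ (subBlocks b diagonalBlock-nonzero) x)) x′

    s-maps-sub : MapsFibres s (sub k b) θ
    s-maps-sub x r = r′ , trans e′ (cong (λ y → sub k b y r′) (θ-unique {x} {x′} nz))
      where
      v = proj₁ (s-blk b (combine x r))
      x′ = proj₁ (combine-surjective {2} {k} v)
      r′ = proj₁ (proj₂ (combine-surjective {2} {k} v))
      x′r′≡v = proj₂ (proj₂ (combine-surjective {2} {k} v))
      e′ : s (sub k b x r) ≡ sub k b x′ r′
      e′ = trans (proj₂ (s-blk b (combine x r))) (cong (blk k b) (sym x′r′≡v))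
      nz : NonZeroMat (SubBlock k (Block k M b b) x x′)
      nz = entry≢0⇒nonZero {i = r} {r′} (graph-nonzero e′)

    s-sub : MapsFibres s (sub k b) id
    s-sub = mapsFibres-prime⇒id {enc = sub k b} {θ} p-prime 2<p s-periodic
      (λ {x} {r} {x′} {r′} → cong proj₂ ∘ sub-injective k {b} {x} {r} {b} {x′} {r′}) s-maps-sub

  s-sub : ∀ b x r → ∃ λ r′ → s (sub k b x r) ≡ sub k b x r′
  s-sub b x r = WithinBlock.s-sub b (combine x r) x r

  offDiagonal-zero : ∀ b x b′ x′ → ¬ ((b , x) ≡ (b′ , x′)) →
                     ∀ r t → M (sub k b x r) (sub k b′ x′ t) ≡ + 0
  offDiagonal-zero b x b′ x′ bx≢b′x′ r t =
    monomial-off-graph mono (λ e → bx≢b′x′ (sub-injective k (trans (sym (proj₂ (s-sub b x r))) e)))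

  -- r only exhibits the nonzero entry that block monomial form asks for.
  diagonal-signedPerm : ∀ b x → Fin k → IsSignedPerm (λ r t → M (sub k b x r) (sub k b x t))
  diagonal-signedPerm b x r =
    diagonalSubBlocks-signedPerm b (entry≢0⇒nonZero {i = combine x r} {combine x r′} on-graph) x
      (entry≢0⇒nonZero {i = r} {r′} on-graph)
    where
    r′ = proj₁ (s-sub b x r)
    on-graph : M (sub k b x r) (sub k b x r′) ≢ + 0
    on-graph = graph-nonzero (proj₂ (s-sub b x r))

  diagI4Signed : Fin k → IsDiagI4Signed k M
  diagI4Signed r₀ = topLeft-identity , diag4 , offDiagonal-zero , λ b x → diagonal-signedPerm b x r₀

prime-order-blockMonomial⇒diagI4Signed : ∀ {k p} → Prime p → 4 < p → Fin k →
  {M : SqMat (N k)} → IsSignedPerm M → M ^^ p ≈ Id (N k) → BlockMonomial k M → IsDiagI4Signed k M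
prime-order-blockMonomial⇒diagI4Signed p-prime 4<p r₀ (_ , _ , ε±1 , entries) M^p≈I bm =
  PrimeOrderBlockMonomial.diagI4Signed p-prime 4<p ε±1 (signedPermEntries⇒monomial entries) M^p≈I bm r₀

lemma4p2 : (k : ℕ) → 3 ≤ k → k % 2 ≡ 1 →
    (H : SqMat (N k)) → IsKimuraHadamard k H →
    (p : ℕ) → Prime p → 3 < p →
    (Σ ℕ λ m → AutCard H m × p ∣ m) →
    (R S : SqMat (N k)) → InAut H (R , S) → HasOrder (R , S) p →
    BlockMonomial k R → BlockMonomial k S →
    IsDiagI4Signed k R × IsDiagI4Signed k S
lemma4p2 k 3≤k _ _ _ p p-prime 3<p _ _ _ (R-signed , S-signed , _) (_ , (R^p≈I , S^p≈I) , _) R-bm S-bm =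
  prime-order-blockMonomial⇒diagI4Signed p-prime 4<p r₀ R-signed R^p≈I R-bm ,
  prime-order-blockMonomial⇒diagI4Signed p-prime 4<p r₀ S-signed S^p≈I S-bm
  where
  4<p : 4 < p
  4<p = ℕ.≤∧≢⇒< 3<p λ 4≡p → composite⇒¬prime composite[4] (subst Prime (sym 4≡p) p-prime)
  r₀ : Fin k
  r₀ = Fin.fromℕ< (ℕ.≤-trans (s≤s z≤n) 3≤k)
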